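{- For every $f\in\mathbb{Z}/2[r]$, $U(f^2)=(U(f))^2$.
   Context: $\mathbb{Z}/2[r]$ is the polynomial ring over the field with two elements; $F=r(r+1)^3$, $G=r^3(r+1)$. $\mathbb{Z}/2[r]$ is a free $\mathbb{Z}/2[G]$-module with basis $1,r,r^2,r^3$. $U:\mathbb{Z}/2[r]\to\mathbb{Z}/2[r]$ is $U\big(\sum_{i=0}^3 g_i(G)r^i\big)=\sum_{i=0}^3 g_i(F)U(r^i)$ with $U(1)=1$, $U(r)=r$, $U(r^2)=r^2$, $U(r^3)=r^3+r^2+r$. -}

module Defs where

open import Data.Bool using (Bool; true; false; _xor_; _∧_)
open import Data.List using (List; []; _∷_)
open import Data.Nat using (ℕ; zero; suc)
open import Data.Product using (_×_; _,_)
open import Relation.Binary.PropositionalEquality using (_≡_)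

-- Polynomials in ℤ/2[r]: coefficient lists over Bool (= 𝔽₂, with xor as
-- addition and ∧ as multiplication), lowest degree first.
Poly : Set
Poly = List Bool

coeff : Poly → ℕ → Bool
coeff []      _       = false
coeff (a ∷ p) zero    = a
coeff (a ∷ p) (suc n) = coeff p n

-- equality of polynomials (lists may differ by trailing zeros)
infix 4 _≈_
_≈_ : Poly → Poly → Set
p ≈ q = ∀ n → coeff p n ≡ coeff q n

infixl 6 _+P_
_+P_ : Poly → Poly → Poly
[]      +P q       = q
(a ∷ p) +P []      = a ∷ p
(a ∷ p) +P (b ∷ q) = (a xor b) ∷ (p +P q)

scale : Bool → Poly → Poly
scale a []      = []
scale a (b ∷ q) = (a ∧ b) ∷ scale a q

infixl 7 _*P_
_*P_ : Poly → Poly → Poly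
[]      *P q = []
(a ∷ p) *P q = scale a q +P (false ∷ (p *P q))

_∘P_ : Poly → Poly → Poly
[]      ∘P q = []
(a ∷ p) ∘P q = (a ∷ []) +P (q *P (p ∘P q))

rP r2P r3P : Poly
rP  = false ∷ true ∷ []
r2P = false ∷ false ∷ true ∷ []
r3P = false ∷ false ∷ false ∷ true ∷ []

-- F = r(r+1)^3 = r + r² + r³ + r⁴,   G = r³(r+1) = r³ + r⁴
F G : Poly
F = false ∷ true ∷ true ∷ true ∷ true ∷ []
G = false ∷ false ∷ false ∷ true ∷ true ∷ []

-- Coordinates of f in the basis 1, r, r², r³ of ℤ/2[r] over ℤ/2[G]:
-- decomp f = (g₀ , g₁ , g₂ , g₃) with f = Σ gᵢ(G) rⁱ, where each gᵢ is a
-- polynomial (in the variable G).  Computed by Horner in r, using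
-- r·(g₀,g₁,g₂,g₃) = (G g₃, g₀, g₁, g₂ + g₃)  since r⁴ = G + r³.
decomp : Poly → Poly × Poly × Poly × Poly
decomp []      = [] , [] , [] , []
decomp (a ∷ f) with decomp f
... | g₀ , g₁ , g₂ , g₃ = (a ∷ g₃) , g₀ , g₁ , (g₂ +P g₃)

U1 Ur Ur2 Ur3 : Poly
U1  = true ∷ []
Ur  = rP
Ur2 = r2P
Ur3 = false ∷ true ∷ true ∷ true ∷ []

U : Poly → Poly
U f with decomp f
... | g₀ , g₁ , g₂ , g₃ =
  ((g₀ ∘P F) *P U1) +P ((g₁ ∘P F) *P Ur) +P ((g₂ ∘P F) *P Ur2) +P ((g₃ ∘P F) *P Ur3)

{-# OPTIONS --safe #-}
-- Over 𝔽₂ squaring is additive, so if f = Σ gᵢ(G) rⁱ then f² = Σ gᵢ(G)² r²ⁱ,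
-- and reducing with r⁴ = G + r³, r⁶ = G + G r + G r² + r³ expresses the
-- coordinates of f² as polynomials in G and the gᵢ.  Substituting F for G is
-- a ring homomorphism, so U(f²) is these expressions evaluated at F, taken in
-- the basis U(rⁱ).  Squaring U(f) = Σ gᵢ(F) U(rⁱ) directly gives the same
-- result, because the U(rⁱ) satisfy the same relations over F as the rⁱ over G:
-- r⁴ = F + U(r³) and U(r³)² = F + F r + F r² + U(r³).
module Submission where

open import Algebra.Bundles using (CommutativeMonoid; CommutativeRing)
open import Algebra.Structures using (IsCommutativeRing)
open import Algebra.Solver.Ring.AlmostCommutativeRing
  using (fromCommutativeRing; _-Raw-AlmostCommutative⟶_)
open import Data.Bool using (Bool; true; false; _xor_; _∧_; _≟_)
open import Data.Bool.Properties
  using (xor-assoc; xor-comm; xor-identityʳ; xor-same; ∧-comm; ∧-assoc; ∧-zeroʳ; ∧-idem;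
         ∧-distribˡ-xor; ∧-distribʳ-xor; xor-∧-commutativeRing)
open import Data.List using ([]; _∷_)
import Data.Maybe as Maybe
open import Data.Nat using (zero; suc)
open import Data.Product using (_×_; _,_)
open import Data.Product.Relation.Binary.Pointwise.NonDependent using (_×ₛ_)
open import Function using (id; _∘_)
open import Level using (0ℓ)
open import Relation.Binary.Bundles using (Setoid)
open import Relation.Binary.PropositionalEquality as ≡
  using (_≡_; refl; cong; cong₂)
open import Relation.Nullary.Decidable using (dec⇒maybe)

open import Defs

infix 4 _≋_

-- _≈_ unfolds to a Π-type from which Agda cannot infer the two polynomials;
-- wrapping it in a record restores inference of implicit arguments.
record _≋_ (p q : Poly) : Set where
  constructor coeffwise
  field coeff-≡ : p ≈ q

open _≋_

≋-refl : ∀ {p} → p ≋ p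
≋-refl = coeffwise λ _ → refl

≋-reflexive : ∀ {p q} → p ≡ q → p ≋ q
≋-reflexive refl = ≋-refl

≋-sym : ∀ {p q} → p ≋ q → q ≋ p
≋-sym e = coeffwise (≡.sym ∘ coeff-≡ e)

≋-trans : ∀ {p q s} → p ≋ q → q ≋ s → p ≋ s
≋-trans e f = coeffwise λ n → ≡.trans (coeff-≡ e n) (coeff-≡ f n)

≋-setoid : Setoid 0ℓ 0ℓ
≋-setoid = record
  { Carrier = Poly
  ; _≈_ = _≋_
  ; isEquivalence = record { refl = ≋-refl ; sym = ≋-sym ; trans = ≋-trans } }

∷-cong : ∀ {a b p q} → a ≡ b → p ≋ q → a ∷ p ≋ b ∷ q
∷-cong a≡b e = coeffwise λ { zero → a≡b ; (suc n) → coeff-≡ e n }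

∷-injective : ∀ {a b p q} → a ∷ p ≋ b ∷ q → a ≡ b × p ≋ q
∷-injective e = coeff-≡ e zero , coeffwise (coeff-≡ e ∘ suc)

false∷[]≋[] : false ∷ [] ≋ []
false∷[]≋[] = coeffwise λ { zero → refl ; (suc n) → refl }

coeff-+P : ∀ p q n → coeff (p +P q) n ≡ coeff p n xor coeff q n
coeff-+P []      q       n       = refl
coeff-+P (a ∷ p) []      n       = ≡.sym (xor-identityʳ _)
coeff-+P (a ∷ p) (b ∷ q) zero    = refl
coeff-+P (a ∷ p) (b ∷ q) (suc n) = coeff-+P p q n

coeff-scale : ∀ a p n → coeff (scale a p) n ≡ a ∧ coeff p n
coeff-scale a []      n       = ≡.sym (∧-zeroʳ a)
coeff-scale a (b ∷ p) zero    = refl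
coeff-scale a (b ∷ p) (suc n) = coeff-scale a p n

+P-cong : ∀ {p p′ q q′} → p ≋ p′ → q ≋ q′ → p +P q ≋ p′ +P q′
+P-cong {p} {p′} {q} {q′} e f = coeffwise λ n → ≡.trans (coeff-+P p q n)
  (≡.trans (cong₂ _xor_ (coeff-≡ e n) (coeff-≡ f n)) (≡.sym (coeff-+P p′ q′ n)))

+P-congˡ : ∀ p {q q′} → q ≋ q′ → p +P q ≋ p +P q′
+P-congˡ p = +P-cong ≋-refl

+P-congʳ : ∀ q {p p′} → p ≋ p′ → p +P q ≋ p′ +P q
+P-congʳ q e = +P-cong e ≋-refl

+P-self : ∀ p → p +P p ≋ []
+P-self p = coeffwise λ n → ≡.trans (coeff-+P p p n) (xor-same (coeff p n))

scale-cong : ∀ a {p q} → p ≋ q → scale a p ≋ scale a q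
scale-cong a {p} {q} e = coeffwise λ n → ≡.trans (coeff-scale a p n)
  (≡.trans (cong (a ∧_) (coeff-≡ e n)) (≡.sym (coeff-scale a q n)))

scale-false : ∀ p → scale false p ≋ []
scale-false p = coeffwise (coeff-scale false p)

+P-identityʳ : ∀ p → p +P [] ≡ p
+P-identityʳ []      = refl
+P-identityʳ (a ∷ p) = refl

+P-comm : ∀ p q → p +P q ≡ q +P p
+P-comm []      []      = refl
+P-comm []      (b ∷ q) = refl
+P-comm (a ∷ p) []      = refl
+P-comm (a ∷ p) (b ∷ q) = cong₂ _∷_ (xor-comm a b) (+P-comm p q)

+P-assoc : ∀ p q s → (p +P q) +P s ≡ p +P (q +P s)
+P-assoc []      q       s       = refl
+P-assoc (a ∷ p) []      s       = refl
+P-assoc (a ∷ p) (b ∷ q) []      = refl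
+P-assoc (a ∷ p) (b ∷ q) (c ∷ s) = cong₂ _∷_ (xor-assoc a b c) (+P-assoc p q s)

+P-commutativeMonoid : CommutativeMonoid 0ℓ 0ℓ
+P-commutativeMonoid = record
  { Carrier = Poly
  ; _≈_ = _≡_
  ; _∙_ = _+P_
  ; ε = []
  ; isCommutativeMonoid = record
    { isMonoid = record
      { isSemigroup = record
        { isMagma = record { isEquivalence = ≡.isEquivalence ; ∙-cong = cong₂ _+P_ }
        ; assoc = +P-assoc }
      ; identity = (λ _ → refl) , +P-identityʳ }
    ; comm = +P-comm } }

open import Algebra.Properties.CommutativeSemigroup
  (CommutativeMonoid.commutativeSemigroup +P-commutativeMonoid)
  using (interchange; x∙yz≈y∙xz)

scale-+P : ∀ a p q → scale a (p +P q) ≡ scale a p +P scale a q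
scale-+P a []      q       = refl
scale-+P a (b ∷ p) []      = refl
scale-+P a (b ∷ p) (c ∷ q) = cong₂ _∷_ (∧-distribˡ-xor a b c) (scale-+P a p q)

scale-xor : ∀ a b p → scale (a xor b) p ≡ scale a p +P scale b p
scale-xor a b []      = refl
scale-xor a b (c ∷ p) = cong₂ _∷_ (∧-distribʳ-xor c a b) (scale-xor a b p)

scale-scale : ∀ a b p → scale a (scale b p) ≡ scale (a ∧ b) p
scale-scale a b []      = refl
scale-scale a b (c ∷ p) = cong₂ _∷_ (≡.sym (∧-assoc a b c)) (scale-scale a b p)

scale-true : ∀ p → scale true p ≡ p
scale-true []      = refl
scale-true (a ∷ p) = cong (a ∷_) (scale-true p)

open import Relation.Binary.Reasoning.Setoid ≋-setoid

*P-zeroʳ : ∀ p → p *P [] ≋ []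
*P-zeroʳ []      = ≋-refl
*P-zeroʳ (a ∷ p) = ≋-trans (∷-cong refl (*P-zeroʳ p)) false∷[]≋[]

*P-congʳ : ∀ p {q q′} → q ≋ q′ → p *P q ≋ p *P q′
*P-congʳ []      e = ≋-refl
*P-congʳ (a ∷ p) e = +P-cong (scale-cong a e) (∷-cong refl (*P-congʳ p e))

*P-distribʳ : ∀ s p q → (p +P q) *P s ≋ p *P s +P q *P s
*P-distribʳ s []      q       = ≋-refl
*P-distribʳ s (a ∷ p) []      = ≋-reflexive (≡.sym (+P-identityʳ _))
*P-distribʳ s (a ∷ p) (b ∷ q) = begin
  scale (a xor b) s +P (false ∷ (p +P q) *P s)
    ≈⟨ +P-cong (≋-reflexive (scale-xor a b s)) (∷-cong refl (*P-distribʳ s p q)) ⟩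
  (scale a s +P scale b s) +P ((false ∷ p *P s) +P (false ∷ q *P s))
    ≡⟨ interchange (scale a s) (scale b s) _ _ ⟩
  (a ∷ p) *P s +P (b ∷ q) *P s ∎

*P-consʳ : ∀ p b q → p *P (b ∷ q) ≋ scale b p +P (false ∷ p *P q)
*P-consʳ []      b q = ≋-sym false∷[]≋[]
*P-consʳ (a ∷ p) b q = ∷-cong (cong (_xor false) (∧-comm a b)) (begin
  scale a q +P p *P (b ∷ q)                     ≈⟨ +P-congˡ (scale a q) (*P-consʳ p b q) ⟩
  scale a q +P (scale b p +P (false ∷ p *P q))  ≡⟨ x∙yz≈y∙xz (scale a q) (scale b p) _ ⟩
  scale b p +P (scale a q +P (false ∷ p *P q))  ∎)

*P-comm : ∀ p q → p *P q ≋ q *P p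
*P-comm []      q = ≋-sym (*P-zeroʳ q)
*P-comm (a ∷ p) q =
  ≋-trans (+P-congˡ (scale a q) (∷-cong refl (*P-comm p q))) (≋-sym (*P-consʳ q a p))

*P-cong : ∀ {p p′ q q′} → p ≋ p′ → q ≋ q′ → p *P q ≋ p′ *P q′
*P-cong {p} {p′} {q} {q′} e f = begin
  p *P q    ≈⟨ *P-congʳ p f ⟩
  p *P q′   ≈⟨ *P-comm p q′ ⟩
  q′ *P p   ≈⟨ *P-congʳ q′ e ⟩
  q′ *P p′  ≈⟨ *P-comm q′ p′ ⟩
  p′ *P q′  ∎

scale-*P : ∀ a p q → scale a p *P q ≋ scale a (p *P q)
scale-*P a []      q = ≋-refl
scale-*P a (b ∷ p) q = begin
  scale (a ∧ b) q +P (false ∷ scale a p *P q)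
    ≈⟨ +P-cong (≋-reflexive (≡.sym (scale-scale a b q)))
               (∷-cong (≡.sym (∧-zeroʳ a)) (scale-*P a p q)) ⟩
  scale a (scale b q) +P scale a (false ∷ p *P q)
    ≡⟨ ≡.sym (scale-+P a (scale b q) _) ⟩
  scale a ((b ∷ p) *P q) ∎

*P-assoc : ∀ p q s → (p *P q) *P s ≋ p *P (q *P s)
*P-assoc []      q s = ≋-refl
*P-assoc (a ∷ p) q s = begin
  (scale a q +P (false ∷ p *P q)) *P s
    ≈⟨ *P-distribʳ s (scale a q) (false ∷ p *P q) ⟩
  scale a q *P s +P (scale false s +P (false ∷ (p *P q) *P s))
    ≈⟨ +P-cong (scale-*P a q s) (+P-cong (scale-false s) (∷-cong refl (*P-assoc p q s))) ⟩
  (a ∷ p) *P (q *P s) ∎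

*P-identityˡ : ∀ p → (true ∷ []) *P p ≋ p
*P-identityˡ p = begin
  scale true p +P (false ∷ [])  ≈⟨ +P-cong (≋-reflexive (scale-true p)) false∷[]≋[] ⟩
  p +P []                      ≡⟨ +P-identityʳ p ⟩
  p                            ∎

open import Algebra.Consequences.Setoid ≋-setoid
  using (comm∧idˡ⇒id; comm∧distrʳ⇒distr)

+P-*P-isCommutativeRing : IsCommutativeRing _≋_ _+P_ _*P_ id [] (true ∷ [])
+P-*P-isCommutativeRing = record
  { isRing = record
    { +-isAbelianGroup = record
      { isGroup = record
        { isMonoid = record
          { isSemigroup = record
            { isMagma = record
              { isEquivalence = Setoid.isEquivalence ≋-setoid ; ∙-cong = +P-cong }
            ; assoc = λ p q s → ≋-reflexive (+P-assoc p q s) }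
          ; identity = (λ _ → ≋-refl) , ≋-reflexive ∘ +P-identityʳ }
        ; inverse = +P-self , +P-self
        ; ⁻¹-cong = id }
      ; comm = λ p q → ≋-reflexive (+P-comm p q) }
    ; *-cong = *P-cong
    ; *-assoc = *P-assoc
    ; *-identity = comm∧idˡ⇒id *P-comm *P-identityˡ
    ; distrib = comm∧distrʳ⇒distr +P-cong *P-comm *P-distribʳ }
  ; *-comm = *P-comm }

Poly-commutativeRing : CommutativeRing 0ℓ 0ℓ
Poly-commutativeRing = record { isCommutativeRing = +P-*P-isCommutativeRing }

constP : Bool → Poly
constP a = a ∷ []

constP-∧ : ∀ a b → constP (a ∧ b) ≋ constP a *P constP b
constP-∧ a b = ∷-cong (≡.sym (xor-identityʳ (a ∧ b))) ≋-refl

constP-homomorphism :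
  CommutativeRing.rawRing xor-∧-commutativeRing
    -Raw-AlmostCommutative⟶ fromCommutativeRing Poly-commutativeRing
constP-homomorphism = record
  { ⟦_⟧ = constP
  ; +-homo = λ _ _ → ≋-refl
  ; *-homo = constP-∧
  ; -‿homo = λ _ → ≋-refl
  ; 0-homo = false∷[]≋[]
  ; 1-homo = ≋-refl }

open import Algebra.Solver.Ring
  (CommutativeRing.rawRing xor-∧-commutativeRing)
  (fromCommutativeRing Poly-commutativeRing)
  constP-homomorphism
  (λ a b → Maybe.map (λ a≡b → ∷-cong a≡b ≋-refl) (dec⇒maybe (a ≟ b)))
  using (solve; _:=_; _:+_; _:*_; con)

+P-square : ∀ p q → (p +P q) *P (p +P q) ≋ p *P p +P q *P q
+P-square = solve 2 (λ p q → (p :+ q) :* (p :+ q) := p :* p :+ q :* q) ≋-refl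

X : Poly
X = rP

X*P-shift : ∀ p → X *P p ≋ false ∷ p
X*P-shift p = +P-cong (scale-false p) (∷-cong refl (*P-identityˡ p))

∷-as-sum : ∀ a p → a ∷ p ≋ constP a +P X *P p
∷-as-sum a p = ≋-trans (∷-cong (≡.sym (xor-identityʳ a)) ≋-refl)
                       (+P-congˡ (constP a) (≋-sym (X*P-shift p)))

∷-square : ∀ a f → (a ∷ f) *P (a ∷ f) ≋ a ∷ false ∷ f *P f
∷-square a f = begin
  (a ∷ f) *P (a ∷ f)
    ≈⟨ *P-cong (∷-as-sum a f) (∷-as-sum a f) ⟩
  (constP a +P X *P f) *P (constP a +P X *P f)
    ≈⟨ solve 3 (λ c x p → (c :+ x :* p) :* (c :+ x :* p) := c :* c :+ x :* (x :* (p :* p)))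
             ≋-refl (constP a) X f ⟩
  constP a *P constP a +P X *P (X *P (f *P f))
    ≈⟨ +P-cong (≋-sym (constP-∧ a a)) (*P-congʳ X (X*P-shift (f *P f))) ⟩
  constP (a ∧ a) +P X *P (false ∷ f *P f)
    ≈⟨ ≋-sym (∷-as-sum (a ∧ a) _) ⟩
  (a ∧ a) ∷ false ∷ f *P f
    ≡⟨ cong (λ b → b ∷ false ∷ f *P f) (∧-idem a) ⟩
  a ∷ false ∷ f *P f ∎

module _ {c ℓ} (S : Setoid c ℓ) where
  open Setoid S using ()
    renaming (Carrier to A; _≈_ to _∼_; refl to ∼-refl; sym to ∼-sym; trans to ∼-trans)

  horner-cong : (φ : Poly → A) (step : Bool → A → A) →
                (∀ a p → φ (a ∷ p) ∼ step a (φ p)) →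
                (∀ a {x y} → x ∼ y → step a x ∼ step a y) →
                step false (φ []) ∼ φ [] →
                ∀ {p q} → p ≋ q → φ p ∼ φ q
  horner-cong φ step φ-∷ step-cong step-false = φ-cong
    where
    φ-[]-cong : ∀ {p} → [] ≋ p → φ [] ∼ φ p
    φ-[]-cong {[]}        _ = ∼-refl
    φ-[]-cong {true ∷ p}  e with () ← coeff-≡ e zero
    φ-[]-cong {false ∷ p} e = ∼-trans (∼-sym step-false)
      (∼-trans (step-cong false (φ-[]-cong (coeffwise (coeff-≡ e ∘ suc)))) (∼-sym (φ-∷ false p)))

    φ-cong : ∀ {p q} → p ≋ q → φ p ∼ φ q
    φ-cong {[]}            e = φ-[]-cong e
    φ-cong {a ∷ p} {[]}    e = ∼-sym (φ-[]-cong (≋-sym e))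
    φ-cong {a ∷ p} {b ∷ q} e with refl , e′ ← ∷-injective e =
      ∼-trans (φ-∷ a p) (∼-trans (step-cong a (φ-cong e′)) (∼-sym (φ-∷ a q)))

module _ (Q : Poly) where

  ∘P-cong : ∀ {p q} → p ≋ q → p ∘P Q ≋ q ∘P Q
  ∘P-cong = horner-cong ≋-setoid (_∘P Q) (λ a t → constP a +P Q *P t) (λ _ _ → ≋-refl)
    (λ a e → +P-congˡ (constP a) (*P-congʳ Q e)) (+P-cong false∷[]≋[] (*P-zeroʳ Q))

  ∘P-+P : ∀ p q → (p +P q) ∘P Q ≋ p ∘P Q +P q ∘P Q
  ∘P-+P []      q       = ≋-refl
  ∘P-+P (a ∷ p) []      = ≋-reflexive (≡.sym (+P-identityʳ _))
  ∘P-+P (a ∷ p) (b ∷ q) = begin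
    constP a +P constP b +P Q *P ((p +P q) ∘P Q)
      ≈⟨ +P-congˡ (constP a +P constP b) (*P-congʳ Q (∘P-+P p q)) ⟩
    constP a +P constP b +P Q *P (p ∘P Q +P q ∘P Q)
      ≈⟨ solve 5 (λ c d x s t → c :+ d :+ x :* (s :+ t) := (c :+ x :* s) :+ (d :+ x :* t))
               ≋-refl (constP a) (constP b) Q (p ∘P Q) (q ∘P Q) ⟩
    (a ∷ p) ∘P Q +P (b ∷ q) ∘P Q ∎

  ∘P-scale : ∀ a p → scale a p ∘P Q ≋ constP a *P p ∘P Q
  ∘P-scale a []      = ≋-sym (*P-zeroʳ (constP a))
  ∘P-scale a (b ∷ p) = begin
    constP (a ∧ b) +P Q *P (scale a p ∘P Q)
      ≈⟨ +P-cong (constP-∧ a b) (*P-congʳ Q (∘P-scale a p)) ⟩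
    constP a *P constP b +P Q *P (constP a *P p ∘P Q)
      ≈⟨ solve 4 (λ c d x s → c :* d :+ x :* (c :* s) := c :* (d :+ x :* s))
               ≋-refl (constP a) (constP b) Q (p ∘P Q) ⟩
    constP a *P (b ∷ p) ∘P Q ∎

  ∘P-*P : ∀ p q → (p *P q) ∘P Q ≋ p ∘P Q *P q ∘P Q
  ∘P-*P []      q = ≋-refl
  ∘P-*P (a ∷ p) q = begin
    (scale a q +P (false ∷ p *P q)) ∘P Q
      ≈⟨ ∘P-+P (scale a q) (false ∷ p *P q) ⟩
    scale a q ∘P Q +P (constP false +P Q *P ((p *P q) ∘P Q))
      ≈⟨ +P-cong (∘P-scale a q) (+P-cong false∷[]≋[] (*P-congʳ Q (∘P-*P p q))) ⟩
    constP a *P q ∘P Q +P Q *P (p ∘P Q *P q ∘P Q)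
      ≈⟨ solve 4 (λ c x s t → c :* t :+ x :* (s :* t) := (c :+ x :* s) :* t)
               ≋-refl (constP a) Q (p ∘P Q) (q ∘P Q) ⟩
    (a ∷ p) ∘P Q *P q ∘P Q ∎

  X∘P : X ∘P Q ≋ Q
  X∘P = begin
    constP false +P Q *P (constP true +P Q *P [])
      ≈⟨ +P-congˡ (constP false) (*P-congʳ Q (+P-congˡ (constP true) (*P-zeroʳ Q))) ⟩
    constP false +P Q *P constP true
      ≈⟨ solve 1 (λ x → con false :+ x :* con true := x) ≋-refl Q ⟩
    Q ∎

Coords : Set
Coords = Poly × Poly × Poly × Poly

Coords-setoid : Setoid 0ℓ 0ℓ
Coords-setoid = ≋-setoid ×ₛ (≋-setoid ×ₛ (≋-setoid ×ₛ ≋-setoid))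

open Setoid Coords-setoid using ()
  renaming (_≈_ to _≋ᶜ_; refl to ≋ᶜ-refl; sym to ≋ᶜ-sym; trans to ≋ᶜ-trans)

mapᶜ : (Poly → Poly) → Coords → Coords
mapᶜ φ (g₀ , g₁ , g₂ , g₃) = φ g₀ , φ g₁ , φ g₂ , φ g₃

mapᶜ-cong : ∀ {φ} → (∀ {p q} → p ≋ q → φ p ≋ φ q) → ∀ {g h} → g ≋ᶜ h → mapᶜ φ g ≋ᶜ mapᶜ φ h
mapᶜ-cong φ-cong (e₀ , e₁ , e₂ , e₃) = φ-cong e₀ , φ-cong e₁ , φ-cong e₂ , φ-cong e₃

infixr 5 _∷ᶜ_
_∷ᶜ_ : Bool → Coords → Coords
a ∷ᶜ (g₀ , g₁ , g₂ , g₃) = (a ∷ g₃) , g₀ , g₁ , (g₂ +P g₃)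

∷ᶜ-cong : ∀ a {g h} → g ≋ᶜ h → a ∷ᶜ g ≋ᶜ a ∷ᶜ h
∷ᶜ-cong a (e₀ , e₁ , e₂ , e₃) = ∷-cong refl e₃ , e₀ , e₁ , +P-cong e₂ e₃

decomp-cong : ∀ {p q} → p ≋ q → decomp p ≋ᶜ decomp q
decomp-cong = horner-cong Coords-setoid decomp _∷ᶜ_ (λ _ _ → ≋ᶜ-refl) ∷ᶜ-cong
  (false∷[]≋[] , ≋-refl , ≋-refl , ≋-refl)

-- With T standing for G: the coordinates of f² in terms of those of f.
squareCoords : Poly → Coords → Coords
squareCoords T (g₀ , g₁ , g₂ , g₃) =
  g₀ *P g₀ +P T *P (g₂ *P g₂) +P T *P (g₃ *P g₃) ,
  T *P (g₃ *P g₃) ,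
  g₁ *P g₁ +P T *P (g₃ *P g₃) ,
  g₂ *P g₂ +P g₃ *P g₃

squareCoords-∷ᶜ : ∀ a g → squareCoords X (a ∷ᶜ g) ≋ᶜ a ∷ᶜ false ∷ᶜ squareCoords X g
squareCoords-∷ᶜ a (g₀ , g₁ , g₂ , g₃) = e₀ , e₁ , e₂ , e₃
  where
  square₃ : (a ∷ g₃) *P (a ∷ g₃) ≋ constP a +P X *P (X *P (g₃ *P g₃))
  square₃ = ≋-trans (∷-square a g₃) (≋-trans (∷-as-sum a _)
    (+P-congˡ (constP a) (*P-congʳ X (≋-sym (X*P-shift _)))))
  e₀ : (a ∷ g₃) *P (a ∷ g₃) +P X *P (g₁ *P g₁) +P X *P ((g₂ +P g₃) *P (g₂ +P g₃))
     ≋ a ∷ (g₁ *P g₁ +P X *P (g₃ *P g₃) +P (g₂ *P g₂ +P g₃ *P g₃))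
  e₀ = begin
    (a ∷ g₃) *P (a ∷ g₃) +P X *P (g₁ *P g₁) +P X *P ((g₂ +P g₃) *P (g₂ +P g₃))
      ≈⟨ +P-congʳ (X *P ((g₂ +P g₃) *P (g₂ +P g₃))) (+P-congʳ (X *P (g₁ *P g₁)) square₃) ⟩
    constP a +P X *P (X *P (g₃ *P g₃)) +P X *P (g₁ *P g₁) +P X *P ((g₂ +P g₃) *P (g₂ +P g₃))
      ≈⟨ solve 5 (λ c x s t u →
                   c :+ x :* (x :* (u :* u)) :+ x :* (s :* s) :+ x :* ((t :+ u) :* (t :+ u))
                := c :+ x :* (s :* s :+ x :* (u :* u) :+ (t :* t :+ u :* u)))
               ≋-refl (constP a) X g₁ g₂ g₃ ⟩
    constP a +P X *P (g₁ *P g₁ +P X *P (g₃ *P g₃) +P (g₂ *P g₂ +P g₃ *P g₃))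
      ≈⟨ ≋-sym (∷-as-sum a _) ⟩
    a ∷ (g₁ *P g₁ +P X *P (g₃ *P g₃) +P (g₂ *P g₂ +P g₃ *P g₃)) ∎
  e₁ : X *P ((g₂ +P g₃) *P (g₂ +P g₃)) ≋ false ∷ (g₂ *P g₂ +P g₃ *P g₃)
  e₁ = ≋-trans (X*P-shift _) (∷-cong refl (+P-square g₂ g₃))
  e₂ : g₀ *P g₀ +P X *P ((g₂ +P g₃) *P (g₂ +P g₃))
     ≋ g₀ *P g₀ +P X *P (g₂ *P g₂) +P X *P (g₃ *P g₃)
  e₂ = solve 4 (λ s x t u → s :* s :+ x :* ((t :+ u) :* (t :+ u))
                         := s :* s :+ x :* (t :* t) :+ x :* (u :* u)) ≋-refl g₀ X g₂ g₃
  e₃ : g₁ *P g₁ +P (g₂ +P g₃) *P (g₂ +P g₃)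
     ≋ X *P (g₃ *P g₃) +P (g₁ *P g₁ +P X *P (g₃ *P g₃) +P (g₂ *P g₂ +P g₃ *P g₃))
  e₃ = solve 4 (λ s x t u → s :* s :+ (t :+ u) :* (t :+ u)
                         := x :* (u :* u) :+ (s :* s :+ x :* (u :* u) :+ (t :* t :+ u :* u)))
               ≋-refl g₁ X g₂ g₃

decomp-square : ∀ f → decomp (f *P f) ≋ᶜ squareCoords X (decomp f)
decomp-square []      = ≋-sym (+P-cong (*P-zeroʳ X) (*P-zeroʳ X)) , ≋-sym (*P-zeroʳ X) ,
                        ≋-sym (*P-zeroʳ X) , ≋-refl
decomp-square (a ∷ f) = ≋ᶜ-trans (decomp-cong (∷-square a f))
  (≋ᶜ-trans (∷ᶜ-cong a (∷ᶜ-cong false (decomp-square f))) (≋ᶜ-sym (squareCoords-∷ᶜ a (decomp f))))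

module _ (φ : Poly → Poly)
         (φ-+P : ∀ p q → φ (p +P q) ≋ φ p +P φ q)
         (φ-*P : ∀ p q → φ (p *P q) ≋ φ p *P φ q) where

  mapᶜ-squareCoords : ∀ {T T′} → φ T ≋ T′ →
                      ∀ g → mapᶜ φ (squareCoords T g) ≋ᶜ squareCoords T′ (mapᶜ φ g)
  mapᶜ-squareCoords {T} {T′} φT≋T′ (g₀ , g₁ , g₂ , g₃) =
    ≋-trans (φ-+P _ _) (+P-cong (≋-trans (φ-+P _ _) (+P-cong (square g₀) (T-square g₂)))
                                (T-square g₃)) ,
    T-square g₃ ,
    ≋-trans (φ-+P _ _) (+P-cong (square g₁) (T-square g₃)) ,
    ≋-trans (φ-+P _ _) (+P-cong (square g₂) (square g₃))
    where
    square : ∀ p → φ (p *P p) ≋ φ p *P φ p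
    square p = φ-*P p p
    T-square : ∀ p → φ (T *P (p *P p)) ≋ T′ *P (φ p *P φ p)
    T-square p = ≋-trans (φ-*P T _) (*P-cong φT≋T′ (square p))

inUBasis : Coords → Poly
inUBasis (A₀ , A₁ , A₂ , A₃) = A₀ *P U1 +P A₁ *P Ur +P A₂ *P Ur2 +P A₃ *P Ur3

inUBasis-cong : ∀ {A B} → A ≋ᶜ B → inUBasis A ≋ inUBasis B
inUBasis-cong (e₀ , e₁ , e₂ , e₃) =
  +P-cong (+P-cong (+P-cong (*P-cong e₀ ≋-refl) (*P-cong e₁ ≋-refl)) (*P-cong e₂ ≋-refl))
          (*P-cong e₃ ≋-refl)

-- F, U1, Ur, Ur2 and Ur3 are definitionally the polynomials in X written below.
inUBasis-squareCoords : ∀ A → inUBasis (squareCoords F A) ≋ inUBasis A *P inUBasis A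
inUBasis-squareCoords (A₀ , A₁ , A₂ , A₃) = solve 5
  (λ x a₀ a₁ a₂ a₃ →
    let F′  = x :+ x :* x :+ x :* x :* x :+ x :* x :* x :* x
        Ur3′ = x :* x :* x :+ x :* x :+ x
        in-basis = λ b₀ b₁ b₂ b₃ → b₀ :* con true :+ b₁ :* x :+ b₂ :* (x :* x) :+ b₃ :* Ur3′
    in in-basis (a₀ :* a₀ :+ F′ :* (a₂ :* a₂) :+ F′ :* (a₃ :* a₃)) (F′ :* (a₃ :* a₃))
                (a₁ :* a₁ :+ F′ :* (a₃ :* a₃)) (a₂ :* a₂ :+ a₃ :* a₃)
       := in-basis a₀ a₁ a₂ a₃ :* in-basis a₀ a₁ a₂ a₃)
  ≋-refl X A₀ A₁ A₂ A₃

lemma1p4 : ∀ (f : Poly) → U (f *P f) ≈ U f *P U f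
lemma1p4 f = coeff-≡ (begin
  U (f *P f)
    ≡⟨⟩
  inUBasis (mapᶜ (_∘P F) (decomp (f *P f)))
    ≈⟨ inUBasis-cong (mapᶜ-cong (∘P-cong F) (decomp-square f)) ⟩
  inUBasis (mapᶜ (_∘P F) (squareCoords X (decomp f)))
    ≈⟨ inUBasis-cong (mapᶜ-squareCoords (_∘P F) (∘P-+P F) (∘P-*P F) {X} (X∘P F) (decomp f)) ⟩
  inUBasis (squareCoords F (mapᶜ (_∘P F) (decomp f)))
    ≈⟨ inUBasis-squareCoords (mapᶜ (_∘P F) (decomp f)) ⟩
  U f *P U f ∎)
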